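{- Let $n,k_1,k_2,t$ be positive integers with $k_1\geq k_2\geq t+1$ and $n\geq\max\{t+1,k_2-t\}\cdot(t+1)(k_1-t+1)(k_2-t+1)+t+1$. If $k_2=t+1$ and $(k_1,t)\notin\{(2,1),(3,1),(4,1)\}$, then $g_2(k_1,k_2,n,t)>g_1(k_1,k_2,n,t)$.
   Context: Binomial coefficients $\binom{a}{b}$ are $0$ when $b<0$ or $b>a$. $g_1(k,\ell,n,t)=\left(\binom{n-t}{k-t}-\binom{n-\ell-1}{k-t}\right)\left(\binom{n-t}{\ell-t}+t\right)$, $g_2(k,\ell,n,t)=\binom{n-t-1}{k-t-1}\left((t+1)\binom{n-t-1}{\ell-t}+\binom{n-t-1}{\ell-t-1}\right)$. -}

module Defs where

open import Data.Nat using (ℕ)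
open import Data.Nat.Combinatorics using (_C_)
open import Data.Integer using (ℤ; +_; -[1+_]; _+_; _-_; _*_)

-- Binomial coefficient with integer arguments: 0 when b < 0 or b > a
-- (if a < 0 and b ≥ 0 then b > a, so it is 0 as well).
-- For 0 ≤ b ≤ a it is the usual ℕ binomial; ℕ's _C_ already returns 0 when b > a.
binomℤ : ℤ → ℤ → ℤ
binomℤ (+ a) (+ b) = + (a C b)
binomℤ (+ a) -[1+ b ] = + 0
binomℤ -[1+ a ] _ = + 0

g₁ : ℤ → ℤ → ℤ → ℤ → ℤ
g₁ k ℓ n t = (binomℤ (n - t) (k - t) - binomℤ (n - ℓ - + 1) (k - t))
             * (binomℤ (n - t) (ℓ - t) + t)

g₂ : ℤ → ℤ → ℤ → ℤ → ℤ
g₂ k ℓ n t = binomℤ (n - t - + 1) (k - t - + 1)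
             * ((t + + 1) * binomℤ (n - t - + 1) (ℓ - t)
                + binomℤ (n - t - + 1) (ℓ - t - + 1))

{-# OPTIONS --safe #-}
-- Write k₂ = t + 1, k₁ = t + 1 + b and n = t + 2 + N. Then
--   g₁ = (X + Y)(N + 2 + t)  and  g₂ = X((t + 1)(N + 1) + 1),  where X = C(N+1, b), Y = C(N, b),
-- by Pascal's rule, so g₂ - g₁ = tNX - (N + 2 + t)Y. Since (N + 1 - b)X = (N + 1)Y, the sign
-- of this is that of tN(N + 1) - (N + 2 + t)(N + 1 - b), which is positive once N ≥ b + 5,
-- except when t = 1 and b ≤ 2: these are the excluded pairs (k₁, t). The bound on n only
-- serves to guarantee N ≥ b + 5.
module Submission where

open import Data.Empty using (⊥-elim)
open import Data.Integer using (+_) renaming (_<_ to _<ℤ_)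
import Data.Integer as ℤ
import Data.Integer.Properties as ℤ
open import Data.Nat using (ℕ; zero; suc; _+_; _*_; _∸_; _⊔_; _≤_; _<_; z≤n; s≤s; NonZero; >-nonZero)
open import Data.Nat.Combinatorics using (_C_; nCk≡nC[n∸k]; nCn≡1; nC1≡n; k>n⇒nCk≡0; nCk+nC[k+1]≡[n+1]C[k+1])
open import Data.Nat.Properties
open import Data.Nat.Tactic.RingSolver using (solve-∀)
open import Data.Product using (_×_; _,_; ∃; proj₁; proj₂)
open import Function.Base using (_∋_)
open import Relation.Binary.PropositionalEquality using (_≡_; refl; sym; trans; cong; cong₂; subst; module ≡-Reasoning)
open import Relation.Nullary using (¬_)

open import Defs

nC0≡1 : ∀ n → n C 0 ≡ 1
nC0≡1 n = trans (nCk≡nC[n∸k] {0} {n} z≤n) (nCn≡1 n)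

[1+k]*[1+n]C[1+k]≡[1+n]*nCk : ∀ n k → suc k * (suc n C suc k) ≡ suc n * (n C k)
[1+k]*[1+n]C[1+k]≡[1+n]*nCk zero zero = refl
[1+k]*[1+n]C[1+k]≡[1+n]*nCk zero (suc k)
  rewrite k>n⇒nCk≡0 {1} {suc (suc k)} (s≤s (s≤s z≤n)) | k>n⇒nCk≡0 {0} {suc k} (s≤s z≤n)
  = *-zeroʳ (suc (suc k))
[1+k]*[1+n]C[1+k]≡[1+n]*nCk (suc n) zero
  rewrite nC1≡n (suc (suc n)) | nC0≡1 (suc n) | *-identityʳ (suc (suc n)) = +-identityʳ _
[1+k]*[1+n]C[1+k]≡[1+n]*nCk (suc n) (suc k) = begin
  suc (suc k) * (suc (suc n) C suc (suc k)) ≡⟨ cong (suc (suc k) *_) (nCk+nC[k+1]≡[n+1]C[k+1] (suc n) (suc k)) ⟨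
  suc (suc k) * (U + V)                     ≡⟨ split (suc k) U V ⟩
  U + (suc k * U + suc (suc k) * V)         ≡⟨ cong₂ (λ u v → U + (u + v)) ([1+k]*[1+n]C[1+k]≡[1+n]*nCk n k) ([1+k]*[1+n]C[1+k]≡[1+n]*nCk n (suc k)) ⟩
  U + (suc n * P + suc n * Q)               ≡⟨ cong (_+ (suc n * P + suc n * Q)) (nCk+nC[k+1]≡[n+1]C[k+1] n k) ⟨
  (P + Q) + (suc n * P + suc n * Q)         ≡⟨ merge n P Q ⟩
  suc (suc n) * (P + Q)                     ≡⟨ cong (suc (suc n) *_) (nCk+nC[k+1]≡[n+1]C[k+1] n k) ⟩
  suc (suc n) * (suc n C suc k)             ∎
  where
  open ≡-Reasoning
  P Q U V : ℕ
  P = n C k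
  Q = n C suc k
  U = suc n C suc k
  V = suc n C suc (suc k)
  split : ∀ a u v → suc a * (u + v) ≡ u + (a * u + suc a * v)
  split = solve-∀
  merge : ∀ n p q → (p + q) + (suc n * p + suc n * q) ≡ suc (suc n) * (p + q)
  merge = solve-∀

[1+m+n]∸m≡1+n : ∀ m n → suc (m + n) ∸ m ≡ suc n
[1+m+n]∸m≡1+n m n = trans (+-∸-assoc 1 (m≤m+n m n)) (cong suc (m+n∸m≡n m n))

[1+m]*[1+k+m]Ck≡[1+k+m]*[k+m]Ck : ∀ k m → suc m * (suc (k + m) C k) ≡ suc (k + m) * ((k + m) C k)
[1+m]*[1+k+m]Ck≡[1+k+m]*[k+m]Ck k m = begin
  suc m * (suc (k + m) C k)         ≡⟨ cong (suc m *_) symmetry₁ ⟩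
  suc m * (suc (k + m) C suc m)     ≡⟨ [1+k]*[1+n]C[1+k]≡[1+n]*nCk (k + m) m ⟩
  suc (k + m) * ((k + m) C m)       ≡⟨ cong (suc (k + m) *_) symmetry₀ ⟨
  suc (k + m) * ((k + m) C k)       ∎
  where
  open ≡-Reasoning
  symmetry₁ : suc (k + m) C k ≡ suc (k + m) C suc m
  symmetry₁ = trans (nCk≡nC[n∸k] (m≤n⇒m≤1+n (m≤m+n k m))) (cong (suc (k + m) C_) ([1+m+n]∸m≡1+n k m))
  symmetry₀ : (k + m) C k ≡ (k + m) C m
  symmetry₀ = trans (nCk≡nC[n∸k] (m≤m+n k m)) (cong ((k + m) C_) (m+n∸m≡n k m))

k≤n⇒nCk>0 : ∀ {n k} → k ≤ n → 0 < n C k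
k≤n⇒nCk>0 {n} {zero} _ = ≤-reflexive (sym (nC0≡1 n))
k≤n⇒nCk>0 {suc n} {suc k} (s≤s k≤n) = begin-strict
  0                        <⟨ k≤n⇒nCk>0 k≤n ⟩
  n C k                    ≤⟨ m≤m+n (n C k) (n C suc k) ⟩
  n C k + n C suc k        ≡⟨ nCk+nC[k+1]≡[n+1]C[k+1] n k ⟩
  suc n C suc k            ∎
  where open ≤-Reasoning

m+[1+d]≡n⇒m<n : ∀ m d {n} → m + suc d ≡ n → m < n
m+[1+d]≡n⇒m<n m d refl = m<m+n m (s≤s z≤n)

-- Transporting along m + k ≡ n, rather than matching refl against it, keeps Agda from
-- unfolding the polynomial products when comparing the types below.
at-offset : ∀ (P : ℕ → Set) {m n} → m ≤ n → (∀ k → P (m + k)) → P n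
at-offset P m≤n P[m+_] = subst P (proj₂ (m≤n⇒∃[o]m+o≡n m≤n)) (P[m+_] _)

[N+3][q+1]<N[N+1] : ∀ b q → 3 ≤ b → (suc (suc (b + q)) + 1) * suc q < 1 * (b + q) * suc (b + q)
[N+3][q+1]<N[N+1] b q 3≤b =
  at-offset (λ b → (suc (suc (b + q)) + 1) * suc q < 1 * (b + q) * suc (b + q)) 3≤b
    λ c → m+[1+d]≡n⇒m<n _ (q * c + c * c + 6 * c + 5) (expand c q)
  where
  expand : ∀ c q → (suc (suc (3 + c + q)) + 1) * suc q + suc (q * c + c * c + 6 * c + 5)
                   ≡ 1 * (3 + c + q) * suc (3 + c + q)
  expand = solve-∀

[N+2+t][N+1]<tN[N+1] : ∀ s N → 5 ≤ N → (suc (suc N) + (2 + s)) * suc N < (2 + s) * N * suc N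
[N+2+t][N+1]<tN[N+1] s N 5≤N =
  at-offset (λ N → (suc (suc N) + (2 + s)) * suc N < (2 + s) * N * suc N) 5≤N
    λ r → m+[1+d]≡n⇒m<n _ ((r + 4 * s + s * r) * (6 + r) + 5 + r) (expand s r)
  where
  expand : ∀ s r → (suc (suc (5 + r)) + (2 + s)) * suc (5 + r) + suc ((r + 4 * s + s * r) * (6 + r) + 5 + r)
                   ≡ (2 + s) * (5 + r) * suc (5 + r)
  expand = solve-∀

[N+2+t][q+1]<tN[N+1] : ∀ t b q → 1 ≤ t → (t ≡ 1 → 3 ≤ b) → 5 ≤ q →
  (suc (suc (b + q)) + t) * suc q < t * (b + q) * suc (b + q)
[N+2+t][q+1]<tN[N+1] (suc zero) b q _ t≡1⇒3≤b _ = [N+3][q+1]<N[N+1] b q (t≡1⇒3≤b refl)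
[N+2+t][q+1]<tN[N+1] t@(suc (suc s)) b q _ _ 5≤q = begin-strict
  (suc (suc N) + t) * suc q   ≤⟨ *-monoʳ-≤ (suc (suc N) + t) (s≤s (m≤n+m q b)) ⟩
  (suc (suc N) + t) * suc N   <⟨ [N+2+t][N+1]<tN[N+1] s N (≤-trans 5≤q (m≤n+m q b)) ⟩
  t * N * suc N               ∎
  where
  open ≤-Reasoning
  N : ℕ
  N = b + q

m≡n+o⇒+m-+n≡+o : ∀ {m} n o → m ≡ n + o → + m ℤ.- + n ≡ + o
m≡n+o⇒+m-+n≡+o n o refl =
  trans (ℤ.[+m]-[+n]≡m⊖n (n + o) n) (trans (ℤ.⊖-≥ (m≤m+n n o)) (cong +_ (m+n∸m≡n n o)))

g₁-by-differences : ∀ {k ℓ n t a c d e} →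
  n ℤ.- t ≡ + a → k ℤ.- t ≡ + c → n ℤ.- ℓ ≡ + suc d → ℓ ℤ.- t ≡ + e →
  g₁ k ℓ n t ≡ (+ (a C c) ℤ.- + (d C c)) ℤ.* (+ (a C e) ℤ.+ t)
g₁-by-differences n-t k-t n-ℓ ℓ-t rewrite n-t | k-t | n-ℓ | ℓ-t = refl

g₂-by-differences : ∀ {k ℓ n t a c e} →
  n ℤ.- t ≡ + suc a → k ℤ.- t ≡ + suc c → ℓ ℤ.- t ≡ + suc e →
  g₂ k ℓ n t ≡ + (a C c) ℤ.* ((t ℤ.+ + 1) ℤ.* + (a C suc e) ℤ.+ + (a C e))
g₂-by-differences n-t k-t ℓ-t rewrite n-t | k-t | ℓ-t = refl

module _ (t b q : ℕ) where

  private
    N X Y A : ℕ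
    N = b + q
    X = suc N C b
    Y = N C b
    A = suc (suc N) + t
    k ℓ n : ℤ.ℤ
    k = + suc (t + b)
    ℓ = + suc t
    n = + (t + suc (suc N))

  binomial-gap : A * suc q < t * N * suc N → (X + Y) * A < X * ((t + 1) * suc N + 1)
  binomial-gap cubic = begin-strict
    (X + Y) * A               ≡⟨ *-distribʳ-+ A X Y ⟩
    X * A + Y * A             <⟨ +-monoʳ-< (X * A) Y*A<t*N*X ⟩
    X * A + t * N * X         ≡⟨ collect X N t ⟩
    X * ((t + 1) * suc N + 1) ∎
    where
    open ≤-Reasoning
    instance
      Y≢0 : NonZero Y
      Y≢0 = >-nonZero (k≤n⇒nCk>0 (m≤m+n b q))
    Y*A<t*N*X : Y * A < t * N * X
    Y*A<t*N*X = *-cancelʳ-< (suc q) (Y * A) (t * N * X) (begin-strict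
      Y * A * suc q        ≡⟨ *-assoc Y A (suc q) ⟩
      Y * (A * suc q)      <⟨ *-monoʳ-< Y cubic ⟩
      Y * (t * N * suc N)  ≡⟨ swap Y (t * N) (suc N) ⟩
      t * N * (suc N * Y)  ≡⟨ cong (t * N *_) ([1+m]*[1+k+m]Ck≡[1+k+m]*[k+m]Ck b q) ⟨
      t * N * (suc q * X)  ≡⟨ swap′ (t * N) (suc q) X ⟩
      t * N * X * suc q    ∎)
      where
      swap : ∀ y a c → y * (a * c) ≡ a * (c * y)
      swap = solve-∀
      swap′ : ∀ a c x → a * (c * x) ≡ a * x * c
      swap′ = solve-∀
    collect : ∀ x n t → x * (suc (suc n) + t) + t * n * x ≡ x * ((t + 1) * suc n + 1)
    collect = solve-∀

  private
    n-t : n ℤ.- + t ≡ + suc (suc N)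
    n-t = m≡n+o⇒+m-+n≡+o t (suc (suc N)) refl
    k-t : k ℤ.- + t ≡ + suc b
    k-t = m≡n+o⇒+m-+n≡+o t (suc b) (sym (+-suc t b))
    n-ℓ : n ℤ.- ℓ ≡ + suc N
    n-ℓ = m≡n+o⇒+m-+n≡+o (suc t) (suc N) (+-suc t (suc N))
    ℓ-t : ℓ ℤ.- + t ≡ + 1
    ℓ-t = m≡n+o⇒+m-+n≡+o t 1 (+-comm 1 t)

  g₁≡[X+Y]*[N+2+t] : g₁ k ℓ n (+ t) ≡ + ((X + Y) * A)
  g₁≡[X+Y]*[N+2+t] = begin
    g₁ k ℓ n (+ t)
      ≡⟨ g₁-by-differences {k} {ℓ} {n} {+ t} n-t k-t n-ℓ ℓ-t ⟩
    (+ (suc (suc N) C suc b) ℤ.- + (N C suc b)) ℤ.* (+ (suc (suc N) C 1) ℤ.+ + t)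
      ≡⟨ cong₂ (λ u v → u ℤ.* (+ v ℤ.+ + t)) (m≡n+o⇒+m-+n≡+o (N C suc b) (X + Y) pascal²) (nC1≡n (suc (suc N))) ⟩
    + (X + Y) ℤ.* + A
      ≡⟨ ℤ.pos-* (X + Y) A ⟨
    + ((X + Y) * A) ∎
    where
    open ≡-Reasoning
    pascal² : suc (suc N) C suc b ≡ N C suc b + (X + Y)
    pascal² = begin
      suc (suc N) C suc b         ≡⟨ nCk+nC[k+1]≡[n+1]C[k+1] (suc N) b ⟨
      X + suc N C suc b           ≡⟨ cong (λ z → X + z) (nCk+nC[k+1]≡[n+1]C[k+1] N b) ⟨
      X + (Y + N C suc b)         ≡⟨ rotate X Y (N C suc b) ⟩
      N C suc b + (X + Y)         ∎
      where
      rotate : ∀ x y z → x + (y + z) ≡ z + (x + y)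
      rotate = solve-∀

  g₂≡X*[[t+1][N+1]+1] : g₂ k ℓ n (+ t) ≡ + (X * ((t + 1) * suc N + 1))
  g₂≡X*[[t+1][N+1]+1] = begin
    g₂ k ℓ n (+ t)
      ≡⟨ g₂-by-differences {k} {ℓ} {n} {+ t} n-t k-t ℓ-t ⟩
    + X ℤ.* (+ (t + 1) ℤ.* + (suc N C 1) ℤ.+ + (suc N C 0))
      ≡⟨ cong₂ (λ u v → + X ℤ.* (+ (t + 1) ℤ.* + u ℤ.+ + v)) (nC1≡n (suc N)) (nC0≡1 (suc N)) ⟩
    + X ℤ.* (+ (t + 1) ℤ.* + suc N ℤ.+ + 1)
      ≡⟨ cong (λ u → + X ℤ.* (u ℤ.+ + 1)) (ℤ.pos-* (t + 1) (suc N)) ⟨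
    + X ℤ.* + ((t + 1) * suc N + 1)
      ≡⟨ ℤ.pos-* X ((t + 1) * suc N + 1) ⟨
    + (X * ((t + 1) * suc N + 1)) ∎
    where open ≡-Reasoning

g₁<g₂ : ∀ t b q → 1 ≤ t → (t ≡ 1 → 3 ≤ b) → 5 ≤ q →
  let k = + suc (t + b) ; ℓ = + suc t ; n = + (t + suc (suc (b + q))) in
  g₁ k ℓ n (+ t) <ℤ g₂ k ℓ n (+ t)
g₁<g₂ t b q 1≤t t≡1⇒3≤b 5≤q
  rewrite g₁≡[X+Y]*[N+2+t] t b q | g₂≡X*[[t+1][N+1]+1] t b q
  = ℤ.+<+ (binomial-gap t b q ([N+2+t][q+1]<tN[N+1] t b q 1≤t t≡1⇒3≤b 5≤q))

t≡1⇒3≤b : ∀ t b →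
  ¬ (ℕ × ℕ ∋ (suc (t + b) , t)) ≡ (2 , 1) → ¬ (ℕ × ℕ ∋ (suc (t + b) , t)) ≡ (3 , 1) →
  ¬ (ℕ × ℕ ∋ (suc (t + b) , t)) ≡ (4 , 1) →
  t ≡ 1 → 3 ≤ b
t≡1⇒3≤b .1 0 ≢2,1 _ _ refl = ⊥-elim (≢2,1 refl)
t≡1⇒3≤b .1 1 _ ≢3,1 _ refl = ⊥-elim (≢3,1 refl)
t≡1⇒3≤b .1 2 _ _ ≢4,1 refl = ⊥-elim (≢4,1 refl)
t≡1⇒3≤b .1 (suc (suc (suc b))) _ _ _ refl = s≤s (s≤s (s≤s z≤n))

n≡t+[b+q+2] : ∀ t b n → 1 ≤ t →
  (suc t ⊔ (suc t ∸ t)) * suc t * suc (suc (t + b) ∸ t) * suc (suc t ∸ t) + suc t ≤ n →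
  ∃ λ q → 5 ≤ q × n ≡ t + suc (suc (b + q))
n≡t+[b+q+2] t b n 1≤t n-large = 5 + w , m≤m+n 5 w , trans (sym n≡) (reassoc t b w)
  where
  open ≤-Reasoning
  product : ℕ
  product = (suc t ⊔ (suc t ∸ t)) * suc t * suc (suc (t + b) ∸ t) * suc (suc t ∸ t)
  4[b+2]≤product : 2 * 2 * suc (suc b) * 1 ≤ product
  4[b+2]≤product =
    *-mono-≤ (*-mono-≤ (*-mono-≤ (≤-trans (s≤s 1≤t) (m≤m⊔n (suc t) (suc t ∸ t))) (s≤s 1≤t))
                       (≤-reflexive (cong suc (sym ([1+m+n]∸m≡1+n t b)))))
             (s≤s z≤n)
  n≥ : t + suc (suc (b + 5)) ≤ n
  n≥ = begin
    t + suc (suc (b + 5))   ≡⟨ shuffle t b ⟩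
    (b + 6) + suc t         ≤⟨ +-monoˡ-≤ (suc t) (≤-trans (m≤m+n (b + 6) (3 * b + 2)) (≤-reflexive (expand b))) ⟩
    2 * 2 * suc (suc b) * 1 + suc t ≤⟨ +-monoˡ-≤ (suc t) 4[b+2]≤product ⟩
    product + suc t         ≤⟨ n-large ⟩
    n                       ∎
    where
    shuffle : ∀ t b → t + suc (suc (b + 5)) ≡ (b + 6) + suc t
    shuffle = solve-∀
    expand : ∀ b → (b + 6) + (3 * b + 2) ≡ 2 * 2 * suc (suc b) * 1
    expand = solve-∀
  w : ℕ
  w = proj₁ (m≤n⇒∃[o]m+o≡n n≥)
  n≡ : t + suc (suc (b + 5)) + w ≡ n
  n≡ = proj₂ (m≤n⇒∃[o]m+o≡n n≥)
  reassoc : ∀ t b w → t + suc (suc (b + 5)) + w ≡ t + suc (suc (b + (5 + w)))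
  reassoc = solve-∀

lemma4p5 : (n k₁ k₂ t : ℕ) → 1 ≤ n → 1 ≤ k₁ → 1 ≤ k₂ → 1 ≤ t →
    k₂ ≤ k₁ → suc t ≤ k₂ →
    ((suc t ⊔ (k₂ ∸ t)) * suc t * suc (k₁ ∸ t) * suc (k₂ ∸ t) + suc t ≤ n) →
    k₂ ≡ suc t →
    ¬ ((k₁ , t) ≡ (2 , 1)) → ¬ ((k₁ , t) ≡ (3 , 1)) → ¬ ((k₁ , t) ≡ (4 , 1)) →
    g₁ (+ k₁) (+ k₂) (+ n) (+ t) <ℤ g₂ (+ k₁) (+ k₂) (+ n) (+ t)
lemma4p5 n k₁ .(suc t) t _ _ _ 1≤t k₂≤k₁ _ n-large refl ≢2,1 ≢3,1 ≢4,1
  with m≤n⇒∃[o]m+o≡n k₂≤k₁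
... | b , refl with n≡t+[b+q+2] t b n 1≤t n-large
... | q , 5≤q , refl = g₁<g₂ t b q 1≤t (t≡1⇒3≤b t b ≢2,1 ≢3,1 ≢4,1) 5≤q
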